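{- Let $q=p^e$ with $p$ prime and $e\ge 1$, and let $m$ be an integer with $1\leq m< q-2$. Then for any integers $i,j$ with $1\leq i<j\leq m+1$, the diameter of the jumped Wenger graph $J_m(q,i,j)$ is at most $2(m+1)$.
   Context: Jumped Wenger graph: for a prime power $q$, a positive integer $m$ and integers $1\le i<j\le m+2$, let $(f_1(x),f_2(x),\dots,f_{m+1}(x))$ be the list of monomials $x^k$, $k\in\{0,1,\dots,m+2\}\setminus\{i,j\}$, in increasing order of exponent (so $f_1=1$). $J_m(q,i,j)$ is the bipartite graph whose vertex set is the disjoint union of the point set $\mathbb{F}_q^{m+1}$ (points $P=(p_1,\dots,p_{m+1})$) and the line set $\mathbb{F}_q^{m+1}$ (lines $L=[l_1,\dots,l_{m+1}]$), where $P$ is adjacent to $L$ iff $l_k+p_k=l_1 f_k(p_1)$ for all $k=2,\dots,m+1$. The distance between two vertices is the number of edges in a shortest path joining them, and the diameter is the maximum distance over all pairs of vertices. -}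

module Defs where

open import Level using (0ℓ)
open import Data.Nat as ℕ using (ℕ; zero; suc; _≤_; _<_)
open import Data.Fin using (Fin; zero; suc; toℕ)
open import Data.Empty using (⊥)
open import Data.List using (List; []; _∷_; filter; upTo)
open import Data.Sum using (_⊎_; inj₁; inj₂)
open import Data.Product using (_×_; ∃)
open import Relation.Nullary using (¬_)
open import Relation.Nullary.Decidable using (_×-dec_; ¬?)
open import Relation.Binary.PropositionalEquality using (_≡_)
open import Algebra.Core using (Op₁; Op₂)
open import Algebra.Structures using (IsCommutativeRing)
open import Function.Bundles using (_↔_)

record FiniteField : Set₁ where
  infixl 6 _+_
  infixl 7 _*_
  field
    Carrier  : Set
    _+_ _*_  : Op₂ Carrier
    -_       : Op₁ Carrier
    0# 1#    : Carrier
    isCommutativeRing : IsCommutativeRing _≡_ _+_ _*_ -_ 0# 1#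
    0≢1      : ¬ (0# ≡ 1#)
    inverse  : ∀ x → ¬ (x ≡ 0#) → ∃ λ y → x * y ≡ 1#
    card     : ℕ
    enum     : Fin card ↔ Carrier

  _^_ : Carrier → ℕ → Carrier
  x ^ zero  = 1#
  x ^ suc n = x * (x ^ n)

nthOr : {A : Set} → A → List A → ℕ → A
nthOr d []       _       = d
nthOr d (x ∷ xs) zero    = x
nthOr d (x ∷ xs) (suc n) = nthOr d xs n

jumpedExponents : ℕ → ℕ → ℕ → List ℕ
jumpedExponents m i j =
  filter (λ k → ¬? (k ℕ.≟ i) ×-dec ¬? (k ℕ.≟ j)) (upTo (suc (suc (suc m))))

-- Exponent of f_{k+1}, for a 0-based coordinate index k (so f_1 has index 0).
jumpedExp : ℕ → ℕ → ℕ → ℕ → ℕ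
jumpedExp m i j k = nthOr 0 (jumpedExponents m i j) k

module JumpedWenger (F : FiniteField) (m i j : ℕ) where
  open FiniteField F

  -- points and lines are both F_q^{m+1}; coordinate index 0 is p_1 (resp. l_1)
  Point : Set
  Point = Fin (suc m) → Carrier

  Line : Set
  Line = Fin (suc m) → Carrier

  Incident : Point → Line → Set
  Incident P L = ∀ (k : Fin m) →
    L (suc k) + P (suc k) ≡ L zero * (P zero ^ jumpedExp m i j (toℕ (suc k)))

  Vertex : Set
  Vertex = Point ⊎ Line

  Adj : Vertex → Vertex → Set
  Adj (inj₁ P) (inj₂ L) = Incident P L
  Adj (inj₂ L) (inj₁ P) = Incident P L
  Adj _        _        = ⊥

  data Walk : Vertex → Vertex → ℕ → Set where
    here : ∀ {u} → Walk u u zero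
    step : ∀ {u v w n} → Adj u v → Walk v w n → Walk u w (suc n)

  DistLe : Vertex → Vertex → ℕ → Set
  DistLe u v d = ∃ λ n → n ≤ d × Walk u v n

  DiameterLe : ℕ → Set
  DiameterLe d = ∀ u v → DistLe u v d

module Submission where

-- Walking P, L₁, P₁, L₂, …, the k-th coordinate changes at each step by a multiple of xᵉ - yᵉ, where e is the
-- exponent of f_k and x, y are first coordinates of consecutive points. So two vertices are joined by a walk of
-- length 2(m + 1) once their coordinate differences, read at the exponents {0, …, m + 2} ∖ {i, j}, form a power
-- sum Σ cₜ xₜᵉ on m + 1 distinct nodes (one of them prescribed when an endpoint is a point). Such a power sum
-- exists for every target when a 2 × 2 minor of the coefficients of ∏ₜ (t - xₜ) is nonzero: the two missing
-- exponents leave two free values, fixed by Cramer's rule. The minor is a quadratic in each newly added node with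
-- the previous minor as leading coefficient, so the nodes can be chosen one at a time while q > m + 2.

open import Defs
open import Algebra.Bundles using (CommutativeRing)
open import Algebra.Core using (Op₁; Op₂)
open import Algebra.Structures using (IsCommutativeRing)
import Algebra.Properties.Ring as RingProperties
import Algebra.Properties.Semiring.Mult as SemiringMult
open import Algebra.Solver.Ring.AlmostCommutativeRing
  using (AlmostCommutativeRing; fromCommutativeRing; _-Raw-AlmostCommutative⟶_)
open import Data.Integer as ℤ using (ℤ; -[1+_]; ∣_∣; sign; _◃_; _⊖_)
import Data.Integer.Properties as ℤ
import Data.Sign as Sign
open import Data.Maybe using (Maybe; just; nothing)
open import Data.Nat as ℕ using (ℕ; zero; suc; _∸_; _≤_; _<_; z≤n; s≤s)
open import Data.Nat.Primality using (Prime)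
import Data.Nat.Properties as ℕ
open import Relation.Binary.PropositionalEquality
open import Data.List using (List; []; _∷_; length; _++_; map; filter; upTo; applyUpTo; lookup)
import Data.List.Properties as L
open import Data.List.Relation.Unary.All using (All; []; _∷_)
open import Data.List.Relation.Unary.All.Properties using (¬Any⇒All¬)
open import Data.List.Relation.Unary.Unique.Propositional using (Unique)
open import Data.List.Relation.Unary.AllPairs using ([]; _∷_)
import Data.List.Relation.Unary.Any as Any
open import Data.List.Relation.Unary.Any.Properties using (lookup-index)
import Data.Fin as Fin
open import Data.Fin using (Fin; zero; suc; toℕ)
import Data.Fin.Properties as Fin
open import Function.Bundles using (Injection)
open import Function.Properties.Inverse using (↔-sym; Inverse⇒Injection)
open import Data.Product using (∃; _×_; _,_; proj₁; proj₂)
open import Data.Sum using (_⊎_; inj₁; inj₂)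
open import Function using (id; _∘_)
open import Relation.Nullary using (yes; no; contradiction)
open import Relation.Nullary.Decidable using (_×-dec_; ¬?; decidable-stable; via-injection)
open import Relation.Binary.Definitions using (DecidableEquality)

-- Normal forms must compute, so coefficients live in ℤ rather than in the ring: 1 - 1 reduces to 0 only there.
module IntegerCoefficientSolver
  {c} {A : Set c} {add mul : Op₂ A} {neg : Op₁ A} {0ᴬ 1ᴬ : A}
  (isCommutativeRing : IsCommutativeRing _≡_ add mul neg 0ᴬ 1ᴬ) where

  commutativeRing : CommutativeRing c c
  commutativeRing = record { isCommutativeRing = isCommutativeRing }

  open CommutativeRing commutativeRing
    using (_+_; _*_; -_; 0#; 1#; ring; semiring; +-identityˡ; +-identityʳ; +-assoc; +-comm; *-identityˡ; -‿inverseʳ)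
  open RingProperties ring using (-0#≈0#; -‿distribˡ-*; -‿distribʳ-*; -‿involutive; -‿+-comm)
  open SemiringMult semiring using (×-homo-+; ×1-homo-*) renaming (_×_ to _·_)
  open ≡-Reasoning

  fromℕ : ℕ → A
  fromℕ n = n · 1#

  applySign : Sign.Sign → A → A
  applySign Sign.+ x = x
  applySign Sign.- x = - x

  fromℤ : ℤ → A
  fromℤ z = applySign (sign z) (fromℕ ∣ z ∣)

  fromℤ-◃ : ∀ s n → fromℤ (s ◃ n) ≡ applySign s (fromℕ n)
  fromℤ-◃ Sign.+ zero    = refl
  fromℤ-◃ Sign.- zero    = sym -0#≈0#
  fromℤ-◃ Sign.+ (suc n) = refl
  fromℤ-◃ Sign.- (suc n) = refl

  applySign-* : ∀ s t x y → applySign (s Sign.* t) (x * y) ≡ applySign s x * applySign t y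
  applySign-* Sign.+ Sign.+ x y = refl
  applySign-* Sign.+ Sign.- x y = -‿distribʳ-* x y
  applySign-* Sign.- Sign.+ x y = -‿distribˡ-* x y
  applySign-* Sign.- Sign.- x y = begin
    x * y         ≡⟨ -‿involutive (x * y) ⟨
    - - (x * y)   ≡⟨ cong -_ (-‿distribʳ-* x y) ⟩
    - (x * - y)   ≡⟨ -‿distribˡ-* x (- y) ⟩
    - x * - y     ∎

  fromℤ-* : ∀ a b → fromℤ (a ℤ.* b) ≡ fromℤ a * fromℤ b
  fromℤ-* a b = begin
    fromℤ (s ◃ ∣ a ∣ ℕ.* ∣ b ∣)               ≡⟨ fromℤ-◃ s (∣ a ∣ ℕ.* ∣ b ∣) ⟩
    applySign s (fromℕ (∣ a ∣ ℕ.* ∣ b ∣))     ≡⟨ cong (applySign s) (×1-homo-* ∣ a ∣ ∣ b ∣) ⟩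
    applySign s (fromℕ ∣ a ∣ * fromℕ ∣ b ∣)   ≡⟨ applySign-* (sign a) (sign b) _ _ ⟩
    fromℤ a * fromℤ b                         ∎
    where s = sign a Sign.* sign b

  fromℤ-neg : ∀ a → fromℤ (ℤ.- a) ≡ - fromℤ a
  fromℤ-neg -[1+ n ]      = sym (-‿involutive _)
  fromℤ-neg (ℤ.+ zero)    = sym -0#≈0#
  fromℤ-neg (ℤ.+ (suc n)) = refl

  1+x-[1+y] : ∀ x y → (1# + x) + - (1# + y) ≡ x + - y
  1+x-[1+y] x y = begin
    (1# + x) + - (1# + y)      ≡⟨ cong ((1# + x) +_) (-‿+-comm 1# y) ⟨
    (1# + x) + (- 1# + - y)    ≡⟨ cong (_+ (- 1# + - y)) (+-comm 1# x) ⟩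
    (x + 1#) + (- 1# + - y)    ≡⟨ +-assoc x 1# _ ⟩
    x + (1# + (- 1# + - y))    ≡⟨ cong (x +_) (+-assoc 1# (- 1#) (- y)) ⟨
    x + ((1# + - 1#) + - y)    ≡⟨ cong (λ z → x + (z + - y)) (-‿inverseʳ 1#) ⟩
    x + (0# + - y)             ≡⟨ cong (x +_) (+-identityˡ (- y)) ⟩
    x + - y                    ∎

  fromℤ-⊖ : ∀ m n → fromℤ (m ⊖ n) ≡ fromℕ m + - fromℕ n
  fromℤ-⊖ m zero = begin
    fromℤ (m ⊖ 0)       ≡⟨ cong fromℤ (ℤ.⊖-≥ {m} z≤n) ⟩
    fromℕ m             ≡⟨ +-identityʳ _ ⟨
    fromℕ m + 0#        ≡⟨ cong (fromℕ m +_) -0#≈0# ⟨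
    fromℕ m + - 0#      ∎
  fromℤ-⊖ zero (suc n) = begin
    fromℤ (0 ⊖ suc n)       ≡⟨ cong fromℤ (ℤ.⊖-< {0} {suc n} (s≤s z≤n)) ⟩
    - fromℕ (suc n)         ≡⟨ +-identityˡ _ ⟨
    0# + - fromℕ (suc n)    ∎
  fromℤ-⊖ (suc m) (suc n) = begin
    fromℤ (suc m ⊖ suc n)                 ≡⟨ cong fromℤ (ℤ.[1+m]⊖[1+n]≡m⊖n m n) ⟩
    fromℤ (m ⊖ n)                         ≡⟨ fromℤ-⊖ m n ⟩
    fromℕ m + - fromℕ n                   ≡⟨ 1+x-[1+y] _ _ ⟨
    fromℕ (suc m) + - fromℕ (suc n)       ∎

  fromℤ-+ : ∀ a b → fromℤ (a ℤ.+ b) ≡ fromℤ a + fromℤ b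
  fromℤ-+ -[1+ m ] -[1+ n ] = begin
    - fromℕ (suc (suc (m ℕ.+ n)))          ≡⟨ cong (λ k → - fromℕ k) (ℕ.+-suc (suc m) n) ⟨
    - fromℕ (suc m ℕ.+ suc n)              ≡⟨ cong -_ (×-homo-+ 1# (suc m) (suc n)) ⟩
    - (fromℕ (suc m) + fromℕ (suc n))      ≡⟨ -‿+-comm _ _ ⟨
    - fromℕ (suc m) + - fromℕ (suc n)      ∎
  fromℤ-+ -[1+ m ] (ℤ.+ n) = trans (fromℤ-⊖ n (suc m)) (+-comm _ _)
  fromℤ-+ (ℤ.+ m) -[1+ n ] = fromℤ-⊖ m (suc n)
  fromℤ-+ (ℤ.+ m) (ℤ.+ n)  = ×-homo-+ 1# m n

  almostCommutativeRing : AlmostCommutativeRing c c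
  almostCommutativeRing = fromCommutativeRing commutativeRing

  fromℤ-homomorphism : ℤ.+-*-rawRing -Raw-AlmostCommutative⟶ almostCommutativeRing
  fromℤ-homomorphism = record
    { ⟦_⟧ = fromℤ ; +-homo = fromℤ-+ ; *-homo = fromℤ-* ; -‿homo = fromℤ-neg
    ; 0-homo = refl ; 1-homo = +-identityʳ 1# }

  fromℤ-≟ : ∀ a b → Maybe (fromℤ a ≡ fromℤ b)
  fromℤ-≟ a b with a ℤ.≟ b
  ... | yes refl = just refl
  ... | no _     = nothing

  open import Algebra.Solver.Ring ℤ.+-*-rawRing almostCommutativeRing fromℤ-homomorphism fromℤ-≟ public

module DifferenceOperators
  {c} {A : Set c} {add mul : Op₂ A} {neg : Op₁ A} {0ᴬ 1ᴬ : A}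
  (isCommutativeRing : IsCommutativeRing _≡_ add mul neg 0ᴬ 1ᴬ) where

  open IntegerCoefficientSolver isCommutativeRing
  open CommutativeRing commutativeRing using (_+_; _*_; -_; 0#; 1#; *-identityʳ)
  open ≡-Reasoning

  Seq : Set c
  Seq = ℕ → A

  δ : ℕ → Seq
  δ zero    zero    = 1#
  δ zero    (suc e) = 0#
  δ (suc k) zero    = 0#
  δ (suc k) (suc e) = δ k e

  δ-≢ : ∀ {k e} → k ≢ e → δ k e ≡ 0#
  δ-≢ {zero}  {zero}  k≢e = contradiction refl k≢e
  δ-≢ {zero}  {suc e} k≢e = refl
  δ-≢ {suc k} {zero}  k≢e = refl
  δ-≢ {suc k} {suc e} k≢e = δ-≢ (k≢e ∘ cong suc)

  Δ : A → Seq → Seq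
  Δ x y e = y (suc e) + - x * y e

  Δ* : List A → Seq → Seq
  Δ* []       y = y
  Δ* (x ∷ xs) y = Δ* xs (Δ x y)

  Δ*-cong : ∀ xs {y z : Seq} → (∀ e → y e ≡ z e) → ∀ e → Δ* xs y e ≡ Δ* xs z e
  Δ*-cong []       y≗z = y≗z
  Δ*-cong (x ∷ xs) y≗z = Δ*-cong xs (λ e → cong₂ (λ a b → a + - x * b) (y≗z (suc e)) (y≗z e))

  Δ*-linear : ∀ xs (f g : Seq) a e → Δ* xs (λ t → f t + a * g t) e ≡ Δ* xs f e + a * Δ* xs g e
  Δ*-linear []       f g a e = refl
  Δ*-linear (x ∷ xs) f g a e = begin
    Δ* xs (Δ x (λ t → f t + a * g t)) e    ≡⟨ Δ*-cong xs Δ-linear e ⟩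
    Δ* xs (λ t → Δ x f t + a * Δ x g t) e  ≡⟨ Δ*-linear xs (Δ x f) (Δ x g) a e ⟩
    Δ* xs (Δ x f) e + a * Δ* xs (Δ x g) e  ∎
    where
    Δ-linear : ∀ t → Δ x (λ t → f t + a * g t) t ≡ Δ x f t + a * Δ x g t
    Δ-linear t = solve 6 (λ f₁ a g₁ x f₀ g₀ →
      (f₁ :+ a :* g₁) :+ (:- x) :* (f₀ :+ a :* g₀) := (f₁ :+ (:- x) :* f₀) :+ a :* (g₁ :+ (:- x) :* g₀))
      refl (f (suc t)) a (g (suc t)) x (f t) (g t)

  Δ*-shift : ∀ xs (y : Seq) e → Δ* xs (y ∘ suc) e ≡ Δ* xs y (suc e)
  Δ*-shift []       y e = refl
  Δ*-shift (x ∷ xs) y e = Δ*-shift xs (Δ x y) e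

  -- coeff xs k e is the coefficient of tᵏ⁻ᵉ in ∏_{x ∈ xs} (t - x) (zero if k < e).
  coeff : List A → ℕ → Seq
  coeff xs k = Δ* xs (δ k)

  coeff-∷ : ∀ x xs k e → coeff (x ∷ xs) k e ≡ coeff xs k (suc e) + - x * coeff xs k e
  coeff-∷ x xs k e = trans (Δ*-linear xs (δ k ∘ suc) (δ k) (- x) e)
                           (cong (_+ - x * coeff xs k e) (Δ*-shift xs (δ k) e))

  coeff-shift : ∀ xs k e → coeff xs (suc k) (suc e) ≡ coeff xs k e
  coeff-shift []       k e = refl
  coeff-shift (x ∷ xs) k e = begin
    coeff (x ∷ xs) (suc k) (suc e)                                 ≡⟨ coeff-∷ x xs (suc k) (suc e) ⟩
    coeff xs (suc k) (suc (suc e)) + - x * coeff xs (suc k) (suc e) ≡⟨ cong₂ (λ a b → a + - x * b)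
                                                                        (coeff-shift xs k (suc e)) (coeff-shift xs k e) ⟩
    coeff xs k (suc e) + - x * coeff xs k e                         ≡⟨ coeff-∷ x xs k e ⟨
    coeff (x ∷ xs) k e                                              ∎

  mutual
    coeff-∷-suc : ∀ x xs k → length xs ≤ k → coeff (x ∷ xs) (suc k) 0 ≡ coeff xs k 0
    coeff-∷-suc x xs k ∣xs∣≤k = begin
      coeff (x ∷ xs) (suc k) 0                       ≡⟨ coeff-∷ x xs (suc k) 0 ⟩
      coeff xs (suc k) 1 + - x * coeff xs (suc k) 0  ≡⟨ cong₂ (λ a b → a + - x * b)
                                                          (coeff-shift xs k 0) (coeff-above xs (suc k) (s≤s ∣xs∣≤k)) ⟩
      coeff xs k 0 + - x * 0#                        ≡⟨ solve 2 (λ a x → a :+ (:- x) :* con (ℤ.+ 0) := a) refl _ x ⟩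
      coeff xs k 0                                   ∎

    coeff-above : ∀ xs k → length xs < k → coeff xs k 0 ≡ 0#
    coeff-above []       (suc k) _           = refl
    coeff-above (x ∷ xs) (suc k) (s≤s ∣xs∣<k) =
      trans (coeff-∷-suc x xs k (ℕ.<⇒≤ ∣xs∣<k)) (coeff-above xs k ∣xs∣<k)

  coeff-degree : ∀ xs → coeff xs (length xs) 0 ≡ 1#
  coeff-degree []       = refl
  coeff-degree (x ∷ xs) = trans (coeff-∷-suc x xs (length xs) ℕ.≤-refl) (coeff-degree xs)

  minor : ℕ → ℕ → List A → A
  minor i j xs = coeff xs i 0 * coeff xs j 1 + - (coeff xs j 0 * coeff xs i 1)

  minor-∷ : ∀ i j x xs → minor i j (x ∷ xs) ≡
    minor i j xs * (x * x)
      + (coeff xs j 0 * coeff xs i 2 + - (coeff xs i 0 * coeff xs j 2)) * x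
      + (coeff xs i 1 * coeff xs j 2 + - (coeff xs j 1 * coeff xs i 2))
  minor-∷ i j x xs = begin
    minor i j (x ∷ xs)
      ≡⟨ cong₂ (λ p q → p * q + - (coeff (x ∷ xs) j 0 * coeff (x ∷ xs) i 1)) (coeff-∷ x xs i 0) (coeff-∷ x xs j 1) ⟩
    (a₁ + - x * a₀) * (b₂ + - x * b₁) + - (coeff (x ∷ xs) j 0 * coeff (x ∷ xs) i 1)
      ≡⟨ cong₂ (λ p q → (a₁ + - x * a₀) * (b₂ + - x * b₁) + - (p * q)) (coeff-∷ x xs j 0) (coeff-∷ x xs i 1) ⟩
    (a₁ + - x * a₀) * (b₂ + - x * b₁) + - ((b₁ + - x * b₀) * (a₂ + - x * a₁))
      ≡⟨ solve 7 (λ a₀ a₁ a₂ b₀ b₁ b₂ x →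
           (a₁ :+ (:- x) :* a₀) :* (b₂ :+ (:- x) :* b₁) :+ (:- ((b₁ :+ (:- x) :* b₀) :* (a₂ :+ (:- x) :* a₁)))
           := (a₀ :* b₁ :+ (:- (b₀ :* a₁))) :* (x :* x) :+ (b₀ :* a₂ :+ (:- (a₀ :* b₂))) :* x :+ (a₁ :* b₂ :+ (:- (b₁ :* a₂))))
           refl a₀ a₁ a₂ b₀ b₁ b₂ x ⟩
    minor i j xs * (x * x) + (b₀ * a₂ + - (a₀ * b₂)) * x + (a₁ * b₂ + - (b₁ * a₂)) ∎
    where
    a₀ = coeff xs i 0; a₁ = coeff xs i 1; a₂ = coeff xs i 2
    b₀ = coeff xs j 0; b₁ = coeff xs j 1; b₂ = coeff xs j 2

  minor-top : ∀ i j xs → j ≡ suc (length xs) → minor i j xs ≡ coeff xs i 0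
  minor-top i j xs refl = begin
    coeff xs i 0 * coeff xs (suc n) 1 + - (coeff xs (suc n) 0 * coeff xs i 1)
      ≡⟨ cong₂ (λ p q → coeff xs i 0 * p + - (q * coeff xs i 1))
           (trans (coeff-shift xs n 0) (coeff-degree xs)) (coeff-above xs (suc n) ℕ.≤-refl) ⟩
    coeff xs i 0 * 1# + - (0# * coeff xs i 1)
      ≡⟨ cong (_+ - (0# * coeff xs i 1)) (*-identityʳ _) ⟩
    coeff xs i 0 + - (0# * coeff xs i 1)
      ≡⟨ solve 2 (λ a b → a :- con (ℤ.+ 0) :* b := a) refl (coeff xs i 0) (coeff xs i 1) ⟩
    coeff xs i 0
      ∎
    where n = length xs

range : ℕ → ℕ → List ℕ
range a zero    = []
range a (suc n) = a ∷ range (suc a) n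

applyUpTo-range : ∀ n (f : ℕ → ℕ) a → (∀ t → f t ≡ a ℕ.+ t) → applyUpTo f n ≡ range a n
applyUpTo-range zero    f a f≗a+ = refl
applyUpTo-range (suc n) f a f≗a+ = cong₂ _∷_ (trans (f≗a+ 0) (ℕ.+-identityʳ a))
  (applyUpTo-range n (f ∘ suc) (suc a) (λ t → trans (f≗a+ (suc t)) (ℕ.+-suc a t)))

range-++ : ∀ a b c → range a (b ℕ.+ c) ≡ range a b ++ range (a ℕ.+ b) c
range-++ a zero    c = cong (λ z → range z c) (sym (ℕ.+-identityʳ a))
range-++ a (suc b) c = cong (a ∷_) (trans (range-++ (suc a) b c)
                                          (cong (λ z → range (suc a) b ++ range z c) (sym (ℕ.+-suc a b))))

All-range : ∀ {P : ℕ → Set} a n → (∀ t → a ≤ t → t < a ℕ.+ n → P t) → All P (range a n)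
All-range a zero    h = []
All-range a (suc n) h = h a ℕ.≤-refl (ℕ.m<m+n a (s≤s z≤n))
  ∷ All-range (suc a) n (λ t a<t t<a+1+n → h t (ℕ.<⇒≤ a<t) (subst (t <_) (sym (ℕ.+-suc a n)) t<a+1+n))

nthOr-range-++ : ∀ a n rest r →
  (r < n × nthOr 0 (range a n ++ rest) r ≡ a ℕ.+ r) ⊎
  (n ≤ r × nthOr 0 (range a n ++ rest) r ≡ nthOr 0 rest (r ∸ n))
nthOr-range-++ a zero    rest r       = inj₂ (z≤n , refl)
nthOr-range-++ a (suc n) rest zero    = inj₁ (s≤s z≤n , sym (ℕ.+-identityʳ a))
nthOr-range-++ a (suc n) rest (suc r) with nthOr-range-++ (suc a) n rest r
... | inj₁ (r<n , eq) = inj₁ (s≤s r<n , trans eq (sym (ℕ.+-suc a r)))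
... | inj₂ (n≤r , eq) = inj₂ (s≤s n≤r , eq)

nthOr-range : ∀ a n r → r < n → nthOr 0 (range a n) r ≡ a ℕ.+ r
nthOr-range a (suc n) zero    _         = sym (ℕ.+-identityʳ a)
nthOr-range a (suc n) (suc r) (s≤s r<n) = trans (nthOr-range (suc a) n r r<n) (sym (ℕ.+-suc a r))

module JumpedExponents (m i j : ℕ) (1≤i : 1 ≤ i) (i<j : i < j) (j≤1+m : j ≤ suc m) where

  private
    P? = λ k → ¬? (k ℕ.≟ i) ×-dec ¬? (k ℕ.≟ j)
    X = j ∸ suc i
    Y = suc (suc m) ∸ j

    1+i+X≡j : suc i ℕ.+ X ≡ j
    1+i+X≡j = ℕ.m+[n∸m]≡n i<j

    j+Y≡2+m : j ℕ.+ Y ≡ suc (suc m)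
    j+Y≡2+m = ℕ.m+[n∸m]≡n (ℕ.m≤n⇒m≤1+n j≤1+m)

  jumpedExponents-split : jumpedExponents m i j ≡ range 0 i ++ (range (suc i) X ++ range (suc j) Y)
  jumpedExponents-split = begin
    filter P? (upTo (3 ℕ.+ m))                                 ≡⟨ cong (filter P?) (applyUpTo-range _ id 0 (λ _ → refl)) ⟩
    filter P? (range 0 (3 ℕ.+ m))                              ≡⟨ cong (λ n → filter P? (range 0 n)) 3+m≡ ⟩
    filter P? (range 0 (i ℕ.+ suc (X ℕ.+ suc Y)))              ≡⟨ cong (filter P?) (range-++ 0 i _) ⟩
    filter P? (range 0 i ++ (i ∷ range (suc i) (X ℕ.+ suc Y))) ≡⟨ L.filter-++ P? (range 0 i) _ ⟩
    filter P? (range 0 i) ++ filter P? (i ∷ range (suc i) (X ℕ.+ suc Y))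
      ≡⟨ cong₂ _++_ (L.filter-all P? below-i) (L.filter-reject P? (λ p → proj₁ p refl)) ⟩
    range 0 i ++ filter P? (range (suc i) (X ℕ.+ suc Y))       ≡⟨ cong (λ l → range 0 i ++ filter P? l) (range-++ (suc i) X (suc Y)) ⟩
    range 0 i ++ filter P? (range (suc i) X ++ range (suc i ℕ.+ X) (suc Y))
      ≡⟨ cong (λ z → range 0 i ++ filter P? (range (suc i) X ++ range z (suc Y))) 1+i+X≡j ⟩
    range 0 i ++ filter P? (range (suc i) X ++ (j ∷ range (suc j) Y))
      ≡⟨ cong (range 0 i ++_) (L.filter-++ P? (range (suc i) X) _) ⟩
    range 0 i ++ (filter P? (range (suc i) X) ++ filter P? (j ∷ range (suc j) Y))
      ≡⟨ cong₂ (λ l l′ → range 0 i ++ (l ++ l′)) (L.filter-all P? between) (L.filter-reject P? (λ p → proj₂ p refl)) ⟩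
    range 0 i ++ (range (suc i) X ++ filter P? (range (suc j) Y))
      ≡⟨ cong (λ l → range 0 i ++ (range (suc i) X ++ l)) (L.filter-all P? above-j) ⟩
    range 0 i ++ (range (suc i) X ++ range (suc j) Y)          ∎
    where
    open ≡-Reasoning
    3+m≡ : 3 ℕ.+ m ≡ i ℕ.+ suc (X ℕ.+ suc Y)
    3+m≡ = sym (begin
      i ℕ.+ suc (X ℕ.+ suc Y)   ≡⟨ ℕ.+-suc i _ ⟩
      suc i ℕ.+ (X ℕ.+ suc Y)   ≡⟨ ℕ.+-assoc (suc i) X (suc Y) ⟨
      (suc i ℕ.+ X) ℕ.+ suc Y   ≡⟨ cong (ℕ._+ suc Y) 1+i+X≡j ⟩
      j ℕ.+ suc Y               ≡⟨ ℕ.+-suc j Y ⟩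
      suc (j ℕ.+ Y)             ≡⟨ cong suc j+Y≡2+m ⟩
      3 ℕ.+ m                   ∎)
    below-i = All-range 0 i (λ t _ t<i → (λ t≡i → ℕ.<-irrefl t≡i t<i) , (λ t≡j → ℕ.<-irrefl t≡j (ℕ.<-trans t<i i<j)))
    between = All-range (suc i) X (λ t i<t t<j →
      (λ t≡i → ℕ.<-irrefl (sym t≡i) i<t) , (λ t≡j → ℕ.<-irrefl t≡j (subst (t <_) 1+i+X≡j t<j)))
    above-j = All-range (suc j) Y (λ t j<t _ →
      (λ t≡i → ℕ.<-irrefl (sym t≡i) (ℕ.<-trans i<j j<t)) , (λ t≡j → ℕ.<-irrefl (sym t≡j) j<t))

  jumpedExp-cases : ∀ r → r ≤ m →
    (r < i × jumpedExp m i j r ≡ r) ⊎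
    (i ≤ r × suc r < j × jumpedExp m i j r ≡ suc r) ⊎
    (j ≤ suc r × jumpedExp m i j r ≡ suc (suc r))
  jumpedExp-cases r r≤m with nthOr-range-++ 0 i (range (suc i) X ++ range (suc j) Y) r
  ... | inj₁ (r<i , eq) = inj₁ (r<i , trans (cong (λ l → nthOr 0 l r) jumpedExponents-split) eq)
  ... | inj₂ (i≤r , eq) with nthOr-range-++ (suc i) X (range (suc j) Y) (r ∸ i)
  ...   | inj₁ (r-i<X , eq′) = inj₂ (inj₁ (i≤r , 1+r<j , trans e (trans eq′ (cong suc (ℕ.m+[n∸m]≡n i≤r)))))
    where
    e = trans (cong (λ l → nthOr 0 l r) jumpedExponents-split) eq
    1+r<j : suc r < j
    1+r<j = subst₂ _<_ (cong suc (ℕ.m+[n∸m]≡n i≤r)) 1+i+X≡j (ℕ.+-monoʳ-< (suc i) r-i<X)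
  ...   | inj₂ (X≤r-i , eq′) = inj₂ (inj₂ (j≤1+r , trans e (trans eq′ (trans (nthOr-range (suc j) Y u u<Y) (cong suc j+u≡1+r)))))
    where
    open ≡-Reasoning
    u = r ∸ i ∸ X
    e = trans (cong (λ l → nthOr 0 l r) jumpedExponents-split) eq
    j+u≡1+r : j ℕ.+ u ≡ suc r
    j+u≡1+r = begin
      j ℕ.+ u                     ≡⟨ cong (ℕ._+ u) 1+i+X≡j ⟨
      suc i ℕ.+ X ℕ.+ u           ≡⟨ cong suc (ℕ.+-assoc i X u) ⟩
      suc (i ℕ.+ (X ℕ.+ u))       ≡⟨ cong (λ z → suc (i ℕ.+ z)) (ℕ.m+[n∸m]≡n X≤r-i) ⟩
      suc (i ℕ.+ (r ∸ i))         ≡⟨ cong suc (ℕ.m+[n∸m]≡n i≤r) ⟩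
      suc r                       ∎
    u<Y : u < Y
    u<Y = ℕ.+-cancelˡ-< j u Y (subst₂ _<_ (sym j+u≡1+r) (sym j+Y≡2+m) (s≤s (s≤s r≤m)))
    j≤1+r : j ≤ suc r
    j≤1+r = subst (j ≤_) j+u≡1+r (ℕ.m≤m+n j u)

  coordinateOf : ℕ → ℕ
  coordinateOf e with e ℕ.<? i | e ℕ.<? j
  ... | yes _ | _     = e
  ... | no _  | yes _ = e ∸ 1
  ... | no _  | no _  = e ∸ 2

  record JumpedExponentFacts (r : ℕ) : Set where
    field
      ≢i           : jumpedExp m i j r ≢ i
      ≢j           : jumpedExp m i j r ≢ j
      <3+m         : jumpedExp m i j r < 3 ℕ.+ m
      coordinateOf-jumpedExp : coordinateOf (jumpedExp m i j r) ≡ r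

  jumpedExp-facts : ∀ r → r ≤ m → JumpedExponentFacts r
  jumpedExp-facts r r≤m with jumpedExp-cases r r≤m
  ... | inj₁ (r<i , eq) = record
    { ≢i = λ e≡i → ℕ.<-irrefl (trans (sym eq) e≡i) r<i
    ; ≢j = λ e≡j → ℕ.<-irrefl (trans (sym eq) e≡j) (ℕ.<-trans r<i i<j)
    ; <3+m = subst (_< _) (sym eq) (ℕ.m≤n⇒m≤1+n (ℕ.m≤n⇒m≤1+n (s≤s r≤m)))
    ; coordinateOf-jumpedExp = trans (cong coordinateOf eq) lower }
    where
    lower : coordinateOf r ≡ r
    lower with r ℕ.<? i
    ... | yes _    = refl
    ... | no r≮i   = contradiction r<i r≮i
  ... | inj₂ (inj₁ (i≤r , 1+r<j , eq)) = record
    { ≢i = λ e≡i → ℕ.<-irrefl (sym (trans (sym eq) e≡i)) (s≤s i≤r)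
    ; ≢j = λ e≡j → ℕ.<-irrefl (trans (sym eq) e≡j) 1+r<j
    ; <3+m = subst (_< _) (sym eq) (ℕ.m≤n⇒m≤1+n (ℕ.m≤n⇒m≤1+n (ℕ.<-≤-trans 1+r<j j≤1+m)))
    ; coordinateOf-jumpedExp = trans (cong coordinateOf eq) middle }
    where
    middle : coordinateOf (suc r) ≡ r
    middle with suc r ℕ.<? i | suc r ℕ.<? j
    ... | yes 1+r<i | _     = contradiction (ℕ.m≤n⇒m≤1+n i≤r) (ℕ.<⇒≱ 1+r<i)
    ... | no _      | yes _ = refl
    ... | no _      | no ≮j = contradiction 1+r<j ≮j
  ... | inj₂ (inj₂ (j≤1+r , eq)) = record
    { ≢i = λ e≡i → ℕ.<-irrefl (sym (trans (sym eq) e≡i)) (ℕ.<-≤-trans i<j (ℕ.m≤n⇒m≤1+n j≤1+r))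
    ; ≢j = λ e≡j → ℕ.<-irrefl (sym (trans (sym eq) e≡j)) (s≤s j≤1+r)
    ; <3+m = subst (_< _) (sym eq) (s≤s (s≤s (s≤s r≤m)))
    ; coordinateOf-jumpedExp = trans (cong coordinateOf eq) upper }
    where
    upper : coordinateOf (suc (suc r)) ≡ r
    upper with suc (suc r) ℕ.<? i | suc (suc r) ℕ.<? j
    ... | yes 2+r<i | _         = contradiction (ℕ.<-trans 2+r<i i<j) (ℕ.≤⇒≯ (ℕ.m≤n⇒m≤1+n j≤1+r))
    ... | no _      | yes 2+r<j = contradiction 2+r<j (ℕ.≤⇒≯ (ℕ.m≤n⇒m≤1+n j≤1+r))
    ... | no _      | no _      = refl

  jumpedExp-zero : jumpedExp m i j 0 ≡ 0
  jumpedExp-zero with jumpedExp-cases 0 z≤n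
  ... | inj₁ (_ , eq)               = eq
  ... | inj₂ (inj₁ (i≤0 , _ , _))   = contradiction (ℕ.<-≤-trans 1≤i i≤0) (λ ())
  ... | inj₂ (inj₂ (j≤1 , _))       = contradiction (ℕ.≤-trans (s≤s 1≤i) (ℕ.≤-trans i<j j≤1)) (λ { (s≤s ()) })

module _ (F : FiniteField) where

  open FiniteField F
  open IntegerCoefficientSolver isCommutativeRing
  open DifferenceOperators isCommutativeRing
  open CommutativeRing commutativeRing
    using (ring; +-identityˡ; +-comm; +-assoc; *-identityˡ; *-identityʳ; *-assoc; *-comm; zeroʳ; -‿inverseʳ)
  open RingProperties ring using (-0#≈0#; -‿involutive)
  open ≡-Reasoning

  infix 4 _≟_
  _≟_ : DecidableEquality Carrier
  _≟_ = via-injection (Inverse⇒Injection (↔-sym enum)) Fin._≟_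

  inv : ∀ a → a ≢ 0# → Carrier
  inv a a≢0 = proj₁ (inverse a a≢0)

  *-inv : ∀ a (a≢0 : a ≢ 0#) → a * inv a a≢0 ≡ 1#
  *-inv a a≢0 = proj₂ (inverse a a≢0)

  x*y≡0⇒y≡0 : ∀ {x y} → x ≢ 0# → x * y ≡ 0# → y ≡ 0#
  x*y≡0⇒y≡0 {x} {y} x≢0 xy≡0 = begin
    y            ≡⟨ *-identityˡ y ⟨
    1# * y       ≡⟨ cong (_* y) (*-inv x x≢0) ⟨
    (x * w) * y  ≡⟨ cong (_* y) (*-comm x w) ⟩
    (w * x) * y  ≡⟨ *-assoc w x y ⟩
    w * (x * y)  ≡⟨ cong (w *_) xy≡0 ⟩
    w * 0#       ≡⟨ zeroʳ w ⟩
    0#           ∎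
    where w = inv x x≢0

  x-y≡0⇒x≡y : ∀ {x y} → x + - y ≡ 0# → x ≡ y
  x-y≡0⇒x≡y {x} {y} x-y≡0 = begin
    x             ≡⟨ solve 2 (λ x y → x := (x :- y) :+ y) refl x y ⟩
    (x + - y) + y ≡⟨ cong (_+ y) x-y≡0 ⟩
    0# + y        ≡⟨ +-identityˡ y ⟩
    y             ∎

  linear-root : ∀ {u v x} (v≢0 : v ≢ 0#) → u + - x * v ≡ 0# → x ≡ u * inv v v≢0
  linear-root {u} {v} {x} v≢0 eq = begin
    x                            ≡⟨ *-identityʳ x ⟨
    x * 1#                       ≡⟨ cong (x *_) (*-inv v v≢0) ⟨
    x * (v * w)                  ≡⟨ solve 4 (λ u v x w → x :* (v :* w) := u :* w :- (u :+ :- x :* v) :* w) refl u v x w ⟩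
    u * w + - ((u + - x * v) * w) ≡⟨ cong (λ z → u * w + - (z * w)) eq ⟩
    u * w + - (0# * w)           ≡⟨ solve 2 (λ u w → u :* w :- con (ℤ.+ 0) :* w := u :* w) refl u w ⟩
    u * w                        ∎
    where w = inv v v≢0

  open import Data.List.Membership.DecPropositional _≟_ using (_∈_; _∈?_; _∉?_)
  open Injection (Inverse⇒Injection enum) using (to; injective)

  fresh : (xs : List Carrier) → length xs < card → ∃ λ x → All (x ≢_) xs
  fresh xs ∣xs∣<q with Fin.any? (λ k → to k ∉? xs)
  ... | yes (k , k∉xs) = to k , ¬Any⇒All¬ xs k∉xs
  ... | no  none       = contradiction (injective to-a≡to-b) (Fin.<⇒≢ a<b)
    where
    member : ∀ k → to k ∈ xs
    member k = decidable-stable (to k ∈? xs) (λ k∉xs → none (k , k∉xs))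
    collision = Fin.pigeonhole ∣xs∣<q (λ k → Any.index (member k))
    a = proj₁ collision
    b = proj₁ (proj₂ collision)
    a<b = proj₁ (proj₂ (proj₂ collision))
    to-a≡to-b : to a ≡ to b
    to-a≡to-b = begin
      to a                                  ≡⟨ lookup-index (member a) ⟩
      lookup xs (Any.index (member a))      ≡⟨ cong (lookup xs) (proj₂ (proj₂ (proj₂ collision))) ⟩
      lookup xs (Any.index (member b))      ≡⟨ lookup-index (member b) ⟨
      to b                                  ∎

  vieta : ∀ {a b c x y} (a≢0 : a ≢ 0#) → y ≢ x →
    a * (x * x) + b * x + c ≡ 0# → a * (y * y) + b * y + c ≡ 0# → y ≡ (- b + - (a * x)) * inv a a≢0
  vieta {a} {b} {c} {x} {y} a≢0 y≢x Qx≡0 Qy≡0 = linear-root a≢0 (begin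
    (- b + - (a * x)) + - y * a   ≡⟨ solve 4 (λ a b x y → (:- b :- a :* x) :+ :- y :* a := :- (a :* (y :+ x) :+ b)) refl a b x y ⟩
    - (a * (y + x) + b)           ≡⟨ cong -_ (x*y≡0⇒y≡0 (y≢x ∘ x-y≡0⇒x≡y) factored) ⟩
    - 0#                          ≡⟨ -0#≈0# ⟩
    0#                            ∎)
    where
    factored : (y + - x) * (a * (y + x) + b) ≡ 0#
    factored = begin
      (y + - x) * (a * (y + x) + b)                               ≡⟨ solve 5 (λ a b c x y →
        (y :- x) :* (a :* (y :+ x) :+ b) := (a :* (y :* y) :+ b :* y :+ c) :- (a :* (x :* x) :+ b :* x :+ c)) refl a b c x y ⟩
      (a * (y * y) + b * y + c) + - (a * (x * x) + b * x + c)     ≡⟨ cong₂ (λ p q → p + - q) Qy≡0 Qx≡0 ⟩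
      0# + - 0#                                                   ≡⟨ -‿inverseʳ 0# ⟩
      0#                                                          ∎

  quadratic-nonroot : ∀ {a} b c → a ≢ 0# → (xs : List Carrier) → 2 ℕ.+ length xs < card →
    ∃ λ x → All (x ≢_) xs × a * (x * x) + b * x + c ≢ 0#
  quadratic-nonroot {a} b c a≢0 xs 2+∣xs∣<q with fresh xs (ℕ.<-trans (ℕ.n<1+n _) (ℕ.<-trans (ℕ.n<1+n _) 2+∣xs∣<q))
  ... | x₁ , x₁∉xs with a * (x₁ * x₁) + b * x₁ + c ≟ 0#
  ...   | no  x₁-nonroot = x₁ , x₁∉xs , x₁-nonroot
  ...   | yes x₁-root with fresh (x₁ ∷ (- b + - (a * x₁)) * inv a a≢0 ∷ xs) 2+∣xs∣<q
  ...     | x₂ , x₂≢x₁ ∷ x₂≢other ∷ x₂∉xs = x₂ , x₂∉xs , λ x₂-root → x₂≢other (vieta a≢0 x₂≢x₁ x₁-root x₂-root)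

  length-++-≡ : ∀ (A B : List Carrier) {r} → length A ≡ r → length (A ++ B) ≡ r ℕ.+ length B
  length-++-≡ A B ∣A∣≡r = trans (L.length-++ A) (cong (ℕ._+ length B) ∣A∣≡r)

  extend-coeff≢0 : ∀ r B k → Unique B → length B ≤ k → k ≤ r ℕ.+ length B → r ℕ.+ length B < card →
    ∃ λ A → length A ≡ r × Unique (A ++ B) × coeff (A ++ B) k 0 ≢ 0#
  extend-coeff≢0 zero B k uB ∣B∣≤k k≤∣B∣ _ = [] , refl , uB , λ c≡0 → 0≢1 (begin
    0#                   ≡⟨ c≡0 ⟨
    coeff B k 0          ≡⟨ cong (λ n → coeff B n 0) (ℕ.≤-antisym k≤∣B∣ ∣B∣≤k) ⟩
    coeff B (length B) 0 ≡⟨ coeff-degree B ⟩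
    1#                   ∎)
  extend-coeff≢0 (suc r) B k uB ∣B∣≤k k≤1+r+∣B∣ 1+r+∣B∣<q with k ℕ.≤? r ℕ.+ length B
  ... | yes k≤r+∣B∣ with extend-coeff≢0 r B k uB ∣B∣≤k k≤r+∣B∣ (ℕ.<-trans (ℕ.n<1+n _) 1+r+∣B∣<q)
  ...   | A , ∣A∣≡r , uAB , c≢0
          with fresh (coeff (A ++ B) k 1 * inv (coeff (A ++ B) k 0) c≢0 ∷ A ++ B)
                     (subst (λ n → suc n < card) (sym (length-++-≡ A B ∣A∣≡r)) 1+r+∣B∣<q)
  ...     | x , x≢root ∷ x∉AB =
    x ∷ A , cong suc ∣A∣≡r , x∉AB ∷ uAB ,
    λ c′≡0 → x≢root (linear-root c≢0 (trans (sym (coeff-∷ x (A ++ B) k 0)) c′≡0))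
  extend-coeff≢0 (suc r) B k uB ∣B∣≤k k≤1+r+∣B∣ 1+r+∣B∣<q | no k≰r+∣B∣
    with extend-coeff≢0 r B (r ℕ.+ length B) uB (ℕ.m≤n+m _ r) ℕ.≤-refl (ℕ.<-trans (ℕ.n<1+n _) 1+r+∣B∣<q)
  ... | A , ∣A∣≡r , uAB , c≢0
        with fresh (A ++ B) (subst (_< card) (sym (length-++-≡ A B ∣A∣≡r)) (ℕ.<-trans (ℕ.n<1+n _) 1+r+∣B∣<q))
  ...   | x , x∉AB = x ∷ A , cong suc ∣A∣≡r , x∉AB ∷ uAB , λ c′≡0 → c≢0 (begin
    coeff (A ++ B) (r ℕ.+ length B) 0           ≡⟨ coeff-∷-suc x (A ++ B) _ (ℕ.≤-reflexive (length-++-≡ A B ∣A∣≡r)) ⟨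
    coeff (x ∷ A ++ B) (suc (r ℕ.+ length B)) 0 ≡⟨ cong (λ n → coeff (x ∷ A ++ B) n 0) k≡ ⟨
    coeff (x ∷ A ++ B) k 0                      ≡⟨ c′≡0 ⟩
    0#                                          ∎)
    where k≡ = ℕ.≤-antisym k≤1+r+∣B∣ (ℕ.≰⇒> k≰r+∣B∣)

  extend-minor≢0 : ∀ {i j} r B → Unique B → length B ≤ i → i < j → j ≤ suc (r ℕ.+ length B) →
    suc (r ℕ.+ length B) < card → ∃ λ A → length A ≡ r × Unique (A ++ B) × minor i j (A ++ B) ≢ 0#
  extend-minor≢0 {i} {j} r B uB ∣B∣≤i i<j j≤1+r+∣B∣ 1+r+∣B∣<q with j ℕ.≟ suc (r ℕ.+ length B)
  ... | yes j≡ with extend-coeff≢0 r B i uB ∣B∣≤i (ℕ.≤-pred (subst (i <_) j≡ i<j)) (ℕ.<-trans (ℕ.n<1+n _) 1+r+∣B∣<q)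
  ...   | A , ∣A∣≡r , uAB , c≢0 = A , ∣A∣≡r , uAB ,
    c≢0 ∘ trans (sym (minor-top i j (A ++ B) (trans j≡ (cong suc (sym (length-++-≡ A B ∣A∣≡r))))))
  extend-minor≢0 zero B uB ∣B∣≤i i<j j≤1+∣B∣ _ | no j≢ =
    contradiction (ℕ.≤-<-trans ∣B∣≤i i<j) (ℕ.≤⇒≯ (ℕ.≤-pred (ℕ.≤∧≢⇒< j≤1+∣B∣ j≢)))
  extend-minor≢0 {i} {j} (suc r) B uB ∣B∣≤i i<j j≤2+r+∣B∣ 2+r+∣B∣<q | no j≢
    with extend-minor≢0 r B uB ∣B∣≤i i<j (ℕ.≤-pred (ℕ.≤∧≢⇒< j≤2+r+∣B∣ j≢)) (ℕ.<-trans (ℕ.n<1+n _) 2+r+∣B∣<q)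
  ... | A , ∣A∣≡r , uAB , minor≢0
        with quadratic-nonroot
               (coeff xs j 0 * coeff xs i 2 + - (coeff xs i 0 * coeff xs j 2))
               (coeff xs i 1 * coeff xs j 2 + - (coeff xs j 1 * coeff xs i 2)) minor≢0 xs
               (subst (λ n → 2 ℕ.+ n < card) (sym (length-++-≡ A B ∣A∣≡r)) 2+r+∣B∣<q)
    where xs = A ++ B
  ...   | x , x∉AB , nonroot = x ∷ A , cong suc ∣A∣≡r , x∉AB ∷ uAB , nonroot ∘ trans (sym (minor-∷ i j x (A ++ B)))

  cramer₂ : ∀ {p q p′ q′} → p * q′ + - (q * p′) ≢ 0# → ∀ u v →
    ∃ λ s → ∃ λ t → u + s * p + t * q ≡ 0# × v + s * p′ + t * q′ ≡ 0#
  cramer₂ {p} {q} {p′} {q′} d≢0 u v = s , t ,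
    trans (solve 7 (λ p q p′ q′ w u v →
                      u :+ ((q :* v :- q′ :* u) :* w) :* p :+ ((p′ :* u :- p :* v) :* w) :* q
                      := u :- u :* ((p :* q′ :- q :* p′) :* w)) refl p q p′ q′ w u v)
          (cancel u) ,
    trans (solve 7 (λ p q p′ q′ w u v →
                      v :+ ((q :* v :- q′ :* u) :* w) :* p′ :+ ((p′ :* u :- p :* v) :* w) :* q′
                      := v :- v :* ((p :* q′ :- q :* p′) :* w)) refl p q p′ q′ w u v)
          (cancel v)
    where
    w = inv _ d≢0
    s = (q * v + - (q′ * u)) * w
    t = (p′ * u + - (p * v)) * w
    cancel : ∀ x → x + - (x * ((p * q′ + - (q * p′)) * w)) ≡ 0#
    cancel x = begin
      x + - (x * ((p * q′ + - (q * p′)) * w)) ≡⟨ cong (λ z → x + - (x * z)) (*-inv _ d≢0) ⟩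
      x + - (x * 1#)                          ≡⟨ cong (λ z → x + - z) (*-identityʳ x) ⟩
      x + - x                                 ≡⟨ -‿inverseʳ x ⟩
      0#                                      ∎

  powerSum : List (Carrier × Carrier) → Seq
  powerSum []             e = 0#
  powerSum ((a , z) ∷ ws) e = a * z ^ e + powerSum ws e

  -- Δ x multiplies the coefficient of zᵉ by z - x, so dividing by z - x inverts it.
  antidifference : ∀ x (ws : List (Carrier × Carrier)) → All (x ≢_) (map proj₂ ws) → List (Carrier × Carrier)
  antidifference x []             []            = []
  antidifference x ((a , z) ∷ ws) (x≢z ∷ x∉ws) =
    (a * inv (z + - x) (x≢z ∘ sym ∘ x-y≡0⇒x≡y) , z) ∷ antidifference x ws x∉ws

  nodes-antidifference : ∀ x ws x∉ws → map proj₂ (antidifference x ws x∉ws) ≡ map proj₂ ws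
  nodes-antidifference x []             []            = refl
  nodes-antidifference x ((a , z) ∷ ws) (x≢z ∷ x∉ws) = cong (z ∷_) (nodes-antidifference x ws x∉ws)

  antidifference-suc : ∀ x ws x∉ws e →
    powerSum (antidifference x ws x∉ws) (suc e) ≡ x * powerSum (antidifference x ws x∉ws) e + powerSum ws e
  antidifference-suc x []             []            e = solve 1 (λ x → con (ℤ.+ 0) := x :* con (ℤ.+ 0) :+ con (ℤ.+ 0)) refl x
  antidifference-suc x ((a , z) ∷ ws) (x≢z ∷ x∉ws) e = begin
    b * (z * Z) + powerSum W (suc e)            ≡⟨ cong (b * (z * Z) +_) (antidifference-suc x ws x∉ws e) ⟩
    b * (z * Z) + (x * powerSum W e + powerSum ws e)
      ≡⟨ solve 6 (λ b z x Z S s → b :* (z :* Z) :+ (x :* S :+ s) := x :* (b :* Z :+ S) :+ ((b :* (z :- x)) :* Z :+ s))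
           refl b z x Z (powerSum W e) (powerSum ws e) ⟩
    x * (b * Z + powerSum W e) + ((b * (z + - x)) * Z + powerSum ws e)
      ≡⟨ cong (λ c → x * (b * Z + powerSum W e) + (c * Z + powerSum ws e)) b[z-x]≡a ⟩
    x * (b * Z + powerSum W e) + (a * Z + powerSum ws e) ∎
    where
    z-x≢0 = x≢z ∘ sym ∘ x-y≡0⇒x≡y
    b = a * inv (z + - x) z-x≢0
    Z = z ^ e
    W = antidifference x ws x∉ws
    b[z-x]≡a : b * (z + - x) ≡ a
    b[z-x]≡a = begin
      a * inv (z + - x) z-x≢0 * (z + - x) ≡⟨ *-assoc a _ _ ⟩
      a * (inv (z + - x) z-x≢0 * (z + - x)) ≡⟨ cong (a *_) (*-comm _ (z + - x)) ⟩
      a * ((z + - x) * inv (z + - x) z-x≢0) ≡⟨ cong (a *_) (*-inv _ z-x≢0) ⟩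
      a * 1#                              ≡⟨ *-identityʳ a ⟩
      a                                   ∎

  Δ-powerSum⇒powerSum : ∀ N (y : Seq) x ws (x∉ws : All (x ≢_) (map proj₂ ws)) →
    (∀ e → suc e < N → Δ x y e ≡ powerSum ws e) →
    let W = antidifference x ws x∉ws in ∀ e → e < N → y e ≡ powerSum ((y 0 + - powerSum W 0 , x) ∷ W) e
  Δ-powerSum⇒powerSum N y x ws x∉ws Δy≗ws zero _ = begin
    y 0                               ≡⟨ solve 2 (λ y₀ r → y₀ := (y₀ :- r) :+ r) refl (y 0) (powerSum W 0) ⟩
    (y 0 + - powerSum W 0) + powerSum W 0      ≡⟨ cong (_+ powerSum W 0) (*-identityʳ _) ⟨
    (y 0 + - powerSum W 0) * 1# + powerSum W 0 ∎
    where W = antidifference x ws x∉ws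
  Δ-powerSum⇒powerSum N y x ws x∉ws Δy≗ws (suc e) 1+e<N = begin
    y (suc e)                             ≡⟨ solve 3 (λ y₁ y₀ x → y₁ := (y₁ :+ :- x :* y₀) :+ x :* y₀) refl (y (suc e)) (y e) x ⟩
    Δ x y e + x * y e                     ≡⟨ cong₂ (λ p q → p + x * q) (Δy≗ws e 1+e<N)
                                               (Δ-powerSum⇒powerSum N y x ws x∉ws Δy≗ws e (ℕ.<-trans (ℕ.n<1+n e) 1+e<N)) ⟩
    powerSum ws e + x * (b * x ^ e + powerSum W e)
      ≡⟨ solve 5 (λ s x b X S → s :+ x :* (b :* X :+ S) := b :* (x :* X) :+ (x :* S :+ s)) refl (powerSum ws e) x b (x ^ e) (powerSum W e) ⟩
    b * (x * x ^ e) + (x * powerSum W e + powerSum ws e) ≡⟨ cong (b * (x * x ^ e) +_) (antidifference-suc x ws x∉ws e) ⟨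
    b * (x * x ^ e) + powerSum W (suc e)  ∎
    where
    W = antidifference x ws x∉ws
    b = y 0 + - powerSum W 0

  Δ*-vanishes⇒powerSum : ∀ xs → Unique xs → (y : Seq) (n : ℕ) → (∀ e → e < n → Δ* xs y e ≡ 0#) →
    ∃ λ ws → map proj₂ ws ≡ xs × (∀ e → e < n ℕ.+ length xs → y e ≡ powerSum ws e)
  Δ*-vanishes⇒powerSum [] [] y n vanish = [] , refl , λ e e<n+0 → vanish e (subst (e <_) (ℕ.+-identityʳ n) e<n+0)
  Δ*-vanishes⇒powerSum (x ∷ xs) (x∉xs ∷ uxs) y n vanish
    with Δ*-vanishes⇒powerSum xs uxs (Δ x y) n vanish
  ... | ws , nodes-ws , Δy≗ws = (y 0 + - powerSum W 0 , x) ∷ W ,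
    cong (x ∷_) (trans (nodes-antidifference x ws x∉ws′) nodes-ws) ,
    λ e e<n+1+∣xs∣ → Δ-powerSum⇒powerSum (suc (n ℕ.+ length xs)) y x ws x∉ws′ (λ e′ → Δy≗ws e′ ∘ ℕ.≤-pred) e
                       (subst (e <_) (ℕ.+-suc n (length xs)) e<n+1+∣xs∣)
    where
    x∉ws′ = subst (All (x ≢_)) (sym nodes-ws) x∉xs
    W = antidifference x ws x∉ws′

  -- The values at the exponents i and j are free; Cramer's rule chooses them so that Δ* xs vanishes at 0 and 1.
  interpolation : ∀ {m i j} xs → Unique xs → length xs ≡ suc m → minor i j xs ≢ 0# → (T : Seq) →
    ∃ λ ws → map proj₂ ws ≡ xs × (∀ e → e < 3 ℕ.+ m → e ≢ i → e ≢ j → T e ≡ powerSum ws e)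
  interpolation {m} {i} {j} xs uxs ∣xs∣≡1+m minor≢0 T =
    proj₁ representation , proj₁ (proj₂ representation) ,
    λ e e<3+m e≢i e≢j → trans (sym (unperturbed e≢i e≢j))
                              (proj₂ (proj₂ representation) e (subst (e <_) (cong (2 ℕ.+_) (sym ∣xs∣≡1+m)) e<3+m))
    where
    solution = cramer₂ minor≢0 (Δ* xs T 0) (Δ* xs T 1)
    s = proj₁ solution
    t = proj₁ (proj₂ solution)

    y : Seq
    y e = T e + s * δ i e + t * δ j e

    Δ*y : ∀ e → Δ* xs y e ≡ Δ* xs T e + s * coeff xs i e + t * coeff xs j e
    Δ*y e = trans (Δ*-linear xs (λ e → T e + s * δ i e) (δ j) t e) (cong (_+ t * coeff xs j e) (Δ*-linear xs T (δ i) s e))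

    vanish : ∀ e → e < 2 → Δ* xs y e ≡ 0#
    vanish 0 _ = trans (Δ*y 0) (proj₁ (proj₂ (proj₂ solution)))
    vanish 1 _ = trans (Δ*y 1) (proj₂ (proj₂ (proj₂ solution)))
    vanish (suc (suc _)) (s≤s (s≤s ()))

    representation = Δ*-vanishes⇒powerSum xs uxs y 2 vanish

    unperturbed : ∀ {e} → e ≢ i → e ≢ j → y e ≡ T e
    unperturbed {e} e≢i e≢j = begin
      T e + s * δ i e + t * δ j e ≡⟨ cong₂ (λ a b → T e + s * a + t * b) (δ-≢ (e≢i ∘ sym)) (δ-≢ (e≢j ∘ sym)) ⟩
      T e + s * 0# + t * 0#       ≡⟨ solve 3 (λ a s t → a :+ s :* con (ℤ.+ 0) :+ t :* con (ℤ.+ 0) := a) refl (T e) s t ⟩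
      T e                         ∎

  powerSum-∷ʳ : ∀ A z (ws : List (Carrier × Carrier)) → map proj₂ ws ≡ A ++ z ∷ [] →
    ∃ λ ws₁ → ∃ λ b → length ws₁ ≡ length A × (∀ e → powerSum ws e ≡ powerSum ws₁ e + b * z ^ e)
  powerSum-∷ʳ []      z ((b , z′) ∷ [])     refl = [] , b , refl , λ e → +-comm _ _
  powerSum-∷ʳ (x ∷ A) z ((a , x′) ∷ ws) nodes-ws with powerSum-∷ʳ A z ws (L.∷-injectiveʳ nodes-ws)
  ... | ws₁ , b , ∣ws₁∣≡∣A∣ , split = (a , x′) ∷ ws₁ , b , cong suc ∣ws₁∣≡∣A∣ ,
    λ e → trans (cong (a * x′ ^ e +_) (split e)) (sym (+-assoc _ _ _))

  module _ (m i j : ℕ) where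

    open JumpedWenger F m i j

    exponent : Fin m → ℕ
    exponent k = jumpedExp m i j (toℕ (suc k))

    lineThrough : Carrier → Point → Line
    lineThrough a Q zero    = a
    lineThrough a Q (suc k) = a * Q zero ^ exponent k + - Q (suc k)

    pointOn : Carrier → Line → Point
    pointOn x L zero    = x
    pointOn x L (suc k) = L zero * x ^ exponent k + - L (suc k)

    incident-lineThrough : ∀ a Q → Incident Q (lineThrough a Q)
    incident-lineThrough a Q k = solve 2 (λ y q → y :- q :+ q := y) refl (a * Q zero ^ exponent k) (Q (suc k))

    incident-pointOn : ∀ x L → Incident (pointOn x L) L
    incident-pointOn x L k = solve 2 (λ l y → l :+ (y :- l) := y) refl (L (suc k)) (L zero * x ^ exponent k)

    viaLineThrough : ∀ {w n} a Q → Walk (inj₂ (lineThrough a Q)) w n → Walk (inj₁ Q) w (suc n)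
    viaLineThrough a Q = step (incident-lineThrough a Q)

    viaPointOn : ∀ {w n} x L → Walk (inj₁ (pointOn x L)) w n → Walk (inj₂ L) w (suc n)
    viaPointOn x L = step (incident-pointOn x L)

    castWalk : ∀ {u v} n → Walk u v (2 ℕ.+ 2 ℕ.* suc n) → Walk u v (2 ℕ.* suc (suc n))
    castWalk n = subst (Walk _ _) (sym (ℕ.*-suc 2 (suc n)))

    -- Summing by parts, a walk Q, L₁, P₁, …, Lₙ, P in which Lₜ has first coordinate aₜ and Pₜ has first
    -- coordinate xₜ moves coordinate k by - a₁ Q₀ᵉ + Σₜ (aₜ - aₜ₊₁) xₜᵉ + aₙ P₀ᵉ, where e = exponent k;
    -- ws lists the middle terms.
    point-to-point : ∀ (Q P : Point) a ws →
      (∀ k → P (suc k) ≡ Q (suc k) + (powerSum ws (exponent k) + - a * Q zero ^ exponent k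
                                     + (a + - powerSum ws 0) * P zero ^ exponent k)) →
      Walk (inj₁ Q) (inj₁ P) (2 ℕ.* suc (length ws))
    point-to-point Q P a [] P≡ = viaLineThrough a Q (step incident here)
      where
      incident : Incident P (lineThrough a Q)
      incident k = begin
        (a * Y + - Q (suc k)) + P (suc k)    ≡⟨ cong ((a * Y + - Q (suc k)) +_) (P≡ k) ⟩
        (a * Y + - Q (suc k)) + (Q (suc k) + (0# + - a * Y + (a + - 0#) * Z))
          ≡⟨ solve 4 (λ a Y q Z → (a :* Y :- q) :+ (q :+ (con (ℤ.+ 0) :+ :- a :* Y :+ (a :- con (ℤ.+ 0)) :* Z)) := a :* Z)
               refl a Y (Q (suc k)) Z ⟩
        a * Z                                ∎
        where
        Y = Q zero ^ exponent k
        Z = P zero ^ exponent k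
    point-to-point Q P a ((b , x) ∷ ws) P≡ =
      castWalk (length ws) (viaLineThrough a Q (viaPointOn x L (point-to-point (pointOn x L) P (a + - b) ws P≡′)))
      where
      L = lineThrough a Q
      P≡′ : ∀ k → P (suc k) ≡ pointOn x L (suc k) + (powerSum ws (exponent k) + - (a + - b) * x ^ exponent k
                                                        + ((a + - b) + - powerSum ws 0) * P zero ^ exponent k)
      P≡′ k = begin
        P (suc k)                                                                          ≡⟨ P≡ k ⟩
        Q (suc k) + ((b * X + powerSum ws (exponent k)) + - a * Y + (a + - (b * 1# + powerSum ws 0)) * Z)
          ≡⟨ cong (λ c → Q (suc k) + ((b * X + powerSum ws (exponent k)) + - a * Y + (a + - (c + powerSum ws 0)) * Z)) (*-identityʳ b) ⟩
        Q (suc k) + ((b * X + powerSum ws (exponent k)) + - a * Y + (a + - (b + powerSum ws 0)) * Z)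
          ≡⟨ solve 8 (λ q b X S a Y S₀ Z →
               q :+ ((b :* X :+ S) :+ :- a :* Y :+ (a :- (b :+ S₀)) :* Z)
               := (a :* X :- (a :* Y :- q)) :+ (S :+ :- (a :- b) :* X :+ ((a :- b) :- S₀) :* Z))
               refl (Q (suc k)) b X (powerSum ws (exponent k)) a Y (powerSum ws 0) Z ⟩
        pointOn x L (suc k) + (powerSum ws (exponent k) + - (a + - b) * X + ((a + - b) + - powerSum ws 0) * Z) ∎
        where
        X = x ^ exponent k
        Y = Q zero ^ exponent k
        Z = P zero ^ exponent k

    point-to-line : ∀ (Q : Point) (L : Line) a ws → a + - powerSum ws 0 ≡ L zero →
      (∀ k → L (suc k) + Q (suc k) ≡ a * Q zero ^ exponent k + - powerSum ws (exponent k)) →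
      Walk (inj₁ Q) (inj₂ L) (suc (2 ℕ.* length ws))
    point-to-line Q L a [] L₀≡ L≡ = step incident here
      where
      incident : Incident Q L
      incident k = begin
        L (suc k) + Q (suc k)   ≡⟨ L≡ k ⟩
        a * Y + - 0#            ≡⟨ solve 2 (λ a Y → a :* Y :- con (ℤ.+ 0) := (a :- con (ℤ.+ 0)) :* Y) refl a Y ⟩
        (a + - 0#) * Y          ≡⟨ cong (_* Y) L₀≡ ⟩
        L zero * Y              ∎
        where Y = Q zero ^ exponent k
    point-to-line Q L a ((b , x) ∷ ws) L₀≡ L≡ =
      subst (Walk _ _) (cong suc (sym (ℕ.*-suc 2 (length ws))))
        (viaLineThrough a Q (viaPointOn x M (point-to-line (pointOn x M) L (a + - b) ws L₀≡′ L≡′)))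
      where
      M = lineThrough a Q
      L₀≡′ : (a + - b) + - powerSum ws 0 ≡ L zero
      L₀≡′ = begin
        (a + - b) + - powerSum ws 0   ≡⟨ solve 3 (λ a b S → (a :- b) :- S := a :- (b :+ S)) refl a b (powerSum ws 0) ⟩
        a + - (b + powerSum ws 0)      ≡⟨ cong (λ c → a + - (c + powerSum ws 0)) (*-identityʳ b) ⟨
        a + - (b * 1# + powerSum ws 0) ≡⟨ L₀≡ ⟩
        L zero                         ∎
      L≡′ : ∀ k → L (suc k) + pointOn x M (suc k) ≡ (a + - b) * x ^ exponent k + - powerSum ws (exponent k)
      L≡′ k = begin
        L (suc k) + (a * X + - (a * Y + - Q (suc k)))
          ≡⟨ solve 5 (λ l a X Y q → l :+ (a :* X :- (a :* Y :- q)) := (l :+ q) :+ a :* X :- a :* Y)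
               refl (L (suc k)) a X Y (Q (suc k)) ⟩
        (L (suc k) + Q (suc k)) + a * X + - (a * Y)     ≡⟨ cong (λ z → z + a * X + - (a * Y)) (L≡ k) ⟩
        (a * Y + - (b * X + powerSum ws (exponent k))) + a * X + - (a * Y)
          ≡⟨ solve 5 (λ a Y b X S → (a :* Y :- (b :* X :+ S)) :+ a :* X :- a :* Y := (a :- b) :* X :- S)
               refl a Y b X (powerSum ws (exponent k)) ⟩
        (a + - b) * X + - powerSum ws (exponent k)      ∎
        where
        X = x ^ exponent k
        Y = Q zero ^ exponent k

    line-to-line : ∀ (M L : Line) c y ws → L zero + - M zero ≡ c + powerSum ws 0 →
      (∀ k → L (suc k) + - M (suc k) ≡ c * y ^ exponent k + powerSum ws (exponent k)) →
      Walk (inj₂ M) (inj₂ L) (2 ℕ.* suc (length ws))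
    line-to-line M L c y [] L₀≡ L≡ = viaPointOn y M (step incident here)
      where
      incident : Incident (pointOn y M) L
      incident k = begin
        L (suc k) + (M zero * Y + - M (suc k))
          ≡⟨ solve 3 (λ l u v → l :+ (u :- v) := (l :- v) :+ u) refl (L (suc k)) (M zero * Y) (M (suc k)) ⟩
        (L (suc k) + - M (suc k)) + M zero * Y           ≡⟨ cong (_+ M zero * Y) (L≡ k) ⟩
        (c * Y + 0#) + M zero * Y
          ≡⟨ solve 3 (λ c Y M₀ → (c :* Y :+ con (ℤ.+ 0)) :+ M₀ :* Y := ((c :+ con (ℤ.+ 0)) :+ M₀) :* Y) refl c Y (M zero) ⟩
        ((c + 0#) + M zero) * Y                          ≡⟨ cong (λ z → (z + M zero) * Y) L₀≡ ⟨
        ((L zero + - M zero) + M zero) * Y               ≡⟨ cong (_* Y) (solve 2 (λ l M₀ → (l :- M₀) :+ M₀ := l) refl (L zero) (M zero)) ⟩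
        L zero * Y                                       ∎
        where Y = y ^ exponent k
    line-to-line M L c y ((c′ , y′) ∷ ws) L₀≡ L≡ =
      castWalk (length ws) (viaPointOn y M (viaLineThrough (M zero + c) Q (line-to-line M′ L c′ y′ ws L₀≡′ L≡′)))
      where
      Q = pointOn y M
      M′ = lineThrough (M zero + c) Q
      L₀≡′ : L zero + - (M zero + c) ≡ c′ + powerSum ws 0
      L₀≡′ = begin
        L zero + - (M zero + c)                  ≡⟨ solve 3 (λ l M₀ c → l :- (M₀ :+ c) := (l :- M₀) :- c) refl (L zero) (M zero) c ⟩
        (L zero + - M zero) + - c                ≡⟨ cong (_+ - c) L₀≡ ⟩
        (c + (c′ * 1# + powerSum ws 0)) + - c    ≡⟨ cong (λ z → (c + (z + powerSum ws 0)) + - c) (*-identityʳ c′) ⟩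
        (c + (c′ + powerSum ws 0)) + - c         ≡⟨ solve 3 (λ c c′ S → (c :+ (c′ :+ S)) :- c := c′ :+ S) refl c c′ (powerSum ws 0) ⟩
        c′ + powerSum ws 0                       ∎
      L≡′ : ∀ k → L (suc k) + - M′ (suc k) ≡ c′ * y′ ^ exponent k + powerSum ws (exponent k)
      L≡′ k = begin
        L (suc k) + - ((M zero + c) * Y + - (M zero * Y + - M (suc k)))
          ≡⟨ solve 5 (λ l M₀ c Y Mₖ → l :- ((M₀ :+ c) :* Y :- (M₀ :* Y :- Mₖ)) := (l :- Mₖ) :- c :* Y)
               refl (L (suc k)) (M zero) c Y (M (suc k)) ⟩
        (L (suc k) + - M (suc k)) + - (c * Y)    ≡⟨ cong (_+ - (c * Y)) (L≡ k) ⟩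
        (c * Y + (c′ * y′ ^ exponent k + powerSum ws (exponent k))) + - (c * Y)
          ≡⟨ solve 2 (λ u v → (u :+ v) :- u := v) refl (c * Y) (c′ * y′ ^ exponent k + powerSum ws (exponent k)) ⟩
        c′ * y′ ^ exponent k + powerSum ws (exponent k) ∎
        where Y = y ^ exponent k

    adjacent-sym : ∀ {u v} → Adj u v → Adj v u
    adjacent-sym {inj₁ P} {inj₂ L} P~L = P~L
    adjacent-sym {inj₂ L} {inj₁ P} P~L = P~L

    walk-∷ʳ : ∀ {u v w n} → Walk u v n → Adj v w → Walk u w (suc n)
    walk-∷ʳ here         v~w = step v~w here
    walk-∷ʳ (step u~ p) v~w = step u~ (walk-∷ʳ p v~w)

    reverseWalk : ∀ {u v n} → Walk u v n → Walk v u n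
    reverseWalk here         = here
    reverseWalk (step u~ p) = walk-∷ʳ (reverseWalk p) (adjacent-sym u~)

    module _ (1≤i : 1 ≤ i) (i<j : i < j) (j≤1+m : j ≤ suc m) (2+m<q : 2 ℕ.+ m < card) where

      open JumpedExponents m i j 1≤i i<j j≤1+m

      atℕ : ∀ {n} → (Fin n → Carrier) → ℕ → Carrier
      atℕ {zero}  t _       = 0#
      atℕ {suc n} t zero    = t zero
      atℕ {suc n} t (suc r) = atℕ (t ∘ suc) r

      atℕ-toℕ : ∀ {n} (t : Fin n → Carrier) r → atℕ t (toℕ r) ≡ t r
      atℕ-toℕ t zero    = refl
      atℕ-toℕ t (suc r) = atℕ-toℕ (t ∘ suc) r

      coordinate-interpolation : ∀ xs → Unique xs → length xs ≡ suc m → minor i j xs ≢ 0# → (t : Fin (suc m) → Carrier) →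
        ∃ λ ws → map proj₂ ws ≡ xs × powerSum ws 0 ≡ t zero × (∀ k → powerSum ws (exponent k) ≡ t (suc k))
      coordinate-interpolation xs uxs ∣xs∣≡1+m minor≢0 t =
        ws , proj₁ (proj₂ representation) , trans (cong (powerSum ws) (sym jumpedExp-zero)) (matches zero) , matches ∘ suc
        where
        representation = interpolation xs uxs ∣xs∣≡1+m minor≢0 (atℕ t ∘ coordinateOf)
        ws = proj₁ representation
        matches : ∀ r → powerSum ws (jumpedExp m i j (toℕ r)) ≡ t r
        matches r = begin
          powerSum ws e           ≡⟨ proj₂ (proj₂ representation) e <3+m ≢i ≢j ⟨
          atℕ t (coordinateOf e)  ≡⟨ cong (atℕ t) coordinateOf-jumpedExp ⟩
          atℕ t (toℕ r)           ≡⟨ atℕ-toℕ t r ⟩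
          t r                     ∎
          where
          e = jumpedExp m i j (toℕ r)
          open JumpedExponentFacts (jumpedExp-facts (toℕ r) (ℕ.≤-pred (Fin.toℕ<n r)))

      record InterpolantThrough (x : Carrier) (t : Fin (suc m) → Carrier) : Set where
        field
          terms        : List (Carrier × Carrier)
          weight       : Carrier
          length-terms : length terms ≡ m
          at-zero      : powerSum terms 0 + weight ≡ t zero
          at-suc       : ∀ k → powerSum terms (exponent k) + weight * x ^ exponent k ≡ t (suc k)

      interpolant-through : ∀ x t → InterpolantThrough x t
      interpolant-through x t = record
        { terms = ws₁ ; weight = b ; length-terms = trans ∣ws₁∣≡∣A∣ ∣A∣≡m
        ; at-zero = trans (cong (powerSum ws₁ 0 +_) (sym (*-identityʳ b))) (trans (sym (split 0)) at-zero)
        ; at-suc = λ k → trans (sym (split (exponent k))) (at-suc k) }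
        where
        nodes = extend-minor≢0 m (x ∷ []) ([] ∷ []) 1≤i i<j
                  (ℕ.≤-trans j≤1+m (s≤s (ℕ.m≤m+n m 1)))
                  (subst (_< card) (cong suc (ℕ.+-comm 1 m)) 2+m<q)
        A = proj₁ nodes
        ∣A∣≡m = proj₁ (proj₂ nodes)
        representation = coordinate-interpolation (A ++ x ∷ []) (proj₁ (proj₂ (proj₂ nodes)))
          (trans (length-++-≡ A (x ∷ []) ∣A∣≡m) (ℕ.+-comm m 1)) (proj₂ (proj₂ (proj₂ nodes))) t
        ws = proj₁ representation
        at-zero = proj₁ (proj₂ (proj₂ representation))
        at-suc = proj₂ (proj₂ (proj₂ representation))
        splitting = powerSum-∷ʳ A x ws (proj₁ (proj₂ representation))
        ws₁ = proj₁ splitting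
        b = proj₁ (proj₂ splitting)
        ∣ws₁∣≡∣A∣ = proj₁ (proj₂ (proj₂ splitting))
        split = proj₂ (proj₂ (proj₂ splitting))

      distance-point-point : ∀ P P′ → DistLe (inj₁ P) (inj₁ P′) (2 ℕ.* suc m)
      distance-point-point P P′ =
        _ , ℕ.≤-reflexive (cong (λ n → 2 ℕ.* suc n) length-terms) , point-to-point P P′ (- weight) terms P′≡
        where
        displacement : Fin (suc m) → Carrier
        displacement zero    = 0#
        displacement (suc k) = P′ (suc k) + - P (suc k)
        open InterpolantThrough (interpolant-through (P zero) displacement)
        P′≡ : ∀ k → P′ (suc k) ≡ P (suc k) + (powerSum terms (exponent k) + - (- weight) * P zero ^ exponent k
                                              + (- weight + - powerSum terms 0) * P′ zero ^ exponent k)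
        P′≡ k = begin
          P′ (suc k)
            ≡⟨ solve 3 (λ p′ p Z → p′ := p :+ (p′ :- p) :+ :- con (ℤ.+ 0) :* Z) refl (P′ (suc k)) (P (suc k)) Z ⟩
          P (suc k) + (P′ (suc k) + - P (suc k)) + - 0# * Z
            ≡⟨ cong₂ (λ u v → P (suc k) + u + - v * Z) (at-suc k) at-zero ⟨
          P (suc k) + (S + weight * Y) + - (S₀ + weight) * Z
            ≡⟨ solve 6 (λ p S w Y S₀ Z → p :+ (S :+ w :* Y) :+ :- (S₀ :+ w) :* Z
                                        := p :+ (S :+ :- (:- w) :* Y :+ (:- w :- S₀) :* Z))
                 refl (P (suc k)) S weight Y S₀ Z ⟩
          P (suc k) + (S + - (- weight) * Y + (- weight + - S₀) * Z) ∎
          where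
          S = powerSum terms (exponent k)
          S₀ = powerSum terms 0
          Y = P zero ^ exponent k
          Z = P′ zero ^ exponent k

      distance-point-line : ∀ P L → DistLe (inj₁ P) (inj₂ L) (2 ℕ.* suc m)
      distance-point-line P L =
        _ , subst (λ n → suc (2 ℕ.* n) ≤ 2 ℕ.* suc m) (sym length-terms) (ℕ.≤-trans (ℕ.n≤1+n _) (ℕ.≤-reflexive (sym (ℕ.*-suc 2 m)))) ,
        point-to-line P L (- weight) terms L₀≡ L≡
        where
        displacement : Fin (suc m) → Carrier
        displacement zero    = - L zero
        displacement (suc k) = - (L (suc k) + P (suc k))
        open InterpolantThrough (interpolant-through (P zero) displacement)
        L₀≡ : - weight + - powerSum terms 0 ≡ L zero
        L₀≡ = begin
          - weight + - powerSum terms 0     ≡⟨ solve 2 (λ w S → :- w :- S := :- (S :+ w)) refl weight (powerSum terms 0) ⟩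
          - (powerSum terms 0 + weight)     ≡⟨ cong -_ at-zero ⟩
          - - L zero                        ≡⟨ -‿involutive (L zero) ⟩
          L zero                            ∎
        L≡ : ∀ k → L (suc k) + P (suc k) ≡ - weight * P zero ^ exponent k + - powerSum terms (exponent k)
        L≡ k = begin
          L (suc k) + P (suc k)             ≡⟨ -‿involutive _ ⟨
          - - (L (suc k) + P (suc k))       ≡⟨ cong -_ (at-suc k) ⟨
          - (S + weight * Y)                ≡⟨ solve 3 (λ S w Y → :- (S :+ w :* Y) := :- w :* Y :- S) refl S weight Y ⟩
          - weight * Y + - S                ∎
          where
          S = powerSum terms (exponent k)
          Y = P zero ^ exponent k

      distance-line-line : ∀ M L → DistLe (inj₂ M) (inj₂ L) (2 ℕ.* suc m)
      distance-line-line M L = walk (proj₁ representation) ∣ws∣≡1+m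
        (proj₁ (proj₂ (proj₂ representation))) (proj₂ (proj₂ (proj₂ representation)))
        where
        nodes = extend-minor≢0 (suc m) [] [] z≤n i<j
                  (ℕ.≤-trans j≤1+m (ℕ.≤-trans (ℕ.n≤1+n _) (ℕ.≤-reflexive (cong (2 ℕ.+_) (sym (ℕ.+-identityʳ m))))))
                  (subst (λ n → 2 ℕ.+ n < card) (sym (ℕ.+-identityʳ m)) 2+m<q)
        A = proj₁ nodes
        A++[]≡A = L.++-identityʳ A
        difference : Fin (suc m) → Carrier
        difference k = L k + - M k
        representation = coordinate-interpolation A (subst Unique A++[]≡A (proj₁ (proj₂ (proj₂ nodes))))
          (proj₁ (proj₂ nodes)) (subst (λ xs → minor i j xs ≢ 0#) A++[]≡A (proj₂ (proj₂ (proj₂ nodes)))) difference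
        ∣ws∣≡1+m : length (proj₁ representation) ≡ suc m
        ∣ws∣≡1+m = trans (sym (L.length-map proj₂ (proj₁ representation))) (trans (cong length (proj₁ (proj₂ representation))) (proj₁ (proj₂ nodes)))
        walk : ∀ ws → length ws ≡ suc m → powerSum ws 0 ≡ difference zero →
               (∀ k → powerSum ws (exponent k) ≡ difference (suc k)) → DistLe (inj₂ M) (inj₂ L) (2 ℕ.* suc m)
        walk ((c , y) ∷ ws) ∣ws∣≡1+m at-zero at-suc =
          _ , ℕ.≤-reflexive (cong (λ n → 2 ℕ.* suc n) (ℕ.suc-injective ∣ws∣≡1+m)) ,
          line-to-line M L c y ws (trans (sym at-zero) (cong (_+ powerSum ws 0) (*-identityʳ c))) (sym ∘ at-suc)

      diameter : DiameterLe (2 ℕ.* suc m)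
      diameter (inj₁ P) (inj₁ P′) = distance-point-point P P′
      diameter (inj₁ P) (inj₂ L)  = distance-point-line P L
      diameter (inj₂ L) (inj₁ P)  = let n , n≤ , p = distance-point-line P L in n , n≤ , reverseWalk p
      diameter (inj₂ M) (inj₂ L)  = distance-line-line M L

open import Data.Nat using (_+_; _*_; _^_)

theorem1 : (F : FiniteField) (p e : ℕ) → Prime p → 1 ≤ e →
    FiniteField.card F ≡ p ^ e →
    (m : ℕ) → 1 ≤ m → m + 2 < FiniteField.card F →
    (i j : ℕ) → 1 ≤ i → i < j → j ≤ m + 1 →
    JumpedWenger.DiameterLe F m i j (2 * (m + 1))
theorem1 F _ _ _ _ _ m _ m+2<q i j 1≤i i<j j≤m+1 =
  subst (JumpedWenger.DiameterLe F m i j) (cong (2 *_) (ℕ.+-comm 1 m))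
    (diameter F m i j 1≤i i<j (subst (j ≤_) (ℕ.+-comm m 1) j≤m+1) (subst (_< FiniteField.card F) (ℕ.+-comm m 2) m+2<q))
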